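{- Let $m$ and $n$ be positive integers and let $\mathcal{P}_n$ be the set of partitions of $n$. For a partition $\lambda\in\mathcal{P}_n$ written as $n=t_1+2t_2+\cdots+nt_n$ (where $t_i$ is the multiplicity of the part $i$, with $t_i=0$ for $i>n$), define for $1\le k\le n$ \[ \alpha_{k,m}(\lambda)=t_{km},\qquad \alpha'_{k,m}(\lambda)=\lfloor t_k/m\rfloor, \] \[ \gamma_m(\lambda)=\sum_{\substack{i\ge 1\\ m\nmid i}} i\,t_i \ \ (\text{the sum of the parts of }\lambda\text{ not divisible by }m\text{, counted with multiplicity}),\qquad \gamma'_m(\lambda)=\sum_{i=1}^{n} i\,\langle t_i\rangle_m . \] Then, as polynomials in the variables $x_1,\dots,x_n,z$, \[ \sum_{\lambda\in\mathcal{P}_n}x_1^{\alpha_{1,m}(\lambda)}x_2^{\alpha_{2,m}(\lambda)}\cdots x_n^{\alpha_{n,m}(\lambda)}z^{\gamma_m(\lambda)} =\sum_{\lambda\in\mathcal{P}_n}x_1^{\alpha'_{1,m}(\lambda)}x_2^{\alpha'_{2,m}(\lambda)}\cdots x_n^{\alpha'_{n,m}(\lambda)}z^{\gamma'_m(\lambda)}. \]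
   Context: $\lfloor x\rfloor$ denotes the integer part of $x$; for an integer $x$, $\langle x\rangle_m$ denotes the least non-negative integer $r$ with $x\equiv r\pmod m$. -}

module Defs where

open import Data.Nat using (ℕ; zero; suc; _*_; _∸_; NonZero)
open import Data.Nat.DivMod using (_/_; _%_)
open import Data.Nat.Divisibility using (_∣?_)
open import Data.Fin using (Fin; toℕ)
open import Data.Vec using (Vec; []; _∷_; sum; tabulate; lookup)
open import Data.Product using (Σ; _×_)
open import Data.Bool using (if_then_else_)
open import Relation.Nullary using (does)
open import Relation.Binary.PropositionalEquality using (_≡_)

-- A partition of n is given by its multiplicity vector (t_1, ..., t_n)
-- (stored 0-based: position i holds t_{i+1}) with  t_1 + 2 t_2 + ... + n t_n = n.
weight : ∀ {n} → Vec ℕ n → ℕ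
weight {n} t = sum (tabulate {n = n} (λ i → suc (toℕ i) * lookup t i))

Partition : ℕ → Set
Partition n = Σ (Vec ℕ n) (λ t → weight t ≡ n)

at : ∀ {n} → Vec ℕ n → ℕ → ℕ
at [] _ = 0
at (x ∷ xs) zero = x
at (x ∷ xs) (suc j) = at xs j

-- mult t i = t_i (multiplicity of part i, for i ≥ 1; t_i = 0 for i > n)
mult : ∀ {n} → Vec ℕ n → ℕ → ℕ
mult t zero = 0
mult t (suc j) = at t j

-- A monomial x_1^{a_1} ... x_n^{a_n} z^c is its exponent vector (a, c).
Monomial : ℕ → Set
Monomial n = Vec ℕ n × ℕ

module _ (m : ℕ) .{{_ : NonZero m}} where

  α : ∀ {n} → Vec ℕ n → Vec ℕ n
  α {n} t = tabulate {n = n} (λ k → mult t (suc (toℕ k) * m))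

  α' : ∀ {n} → Vec ℕ n → Vec ℕ n
  α' {n} t = tabulate {n = n} (λ k → mult t (suc (toℕ k)) / m)

  γ : ∀ {n} → Vec ℕ n → ℕ
  γ {n} t = sum (tabulate {n = n} (λ k →
    if does (m ∣? suc (toℕ k)) then 0 else suc (toℕ k) * mult t (suc (toℕ k))))

  γ' : ∀ {n} → Vec ℕ n → ℕ
  γ' {n} t = sum (tabulate {n = n} (λ k → suc (toℕ k) * (mult t (suc (toℕ k)) % m)))

  monoL : ∀ {n} → Partition n → Monomial n
  monoL (t Data.Product., _) = (α t Data.Product., γ t)

  monoR : ∀ {n} → Partition n → Monomial n
  monoR (t Data.Product., _) = (α' t Data.Product., γ' t)

-- Write every part as c·m^v with m ∤ c. From multiplicities t, merge each m copies of a part i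
-- into one part i·m, and break each of the remaining ⟨t_i⟩_m copies of i = c·m^v into m^v parts c.
-- The new partition has ⌊t_i/m⌋ parts i·m, so its α is α'(t), and for m ∤ c it has
-- Σ_v ⟨t_{c·m^v}⟩_m·m^v parts c, so its γ is Σ_i i·⟨t_i⟩_m = γ'(t). That multiplicity of c is the
-- number with base-m digits ⟨t_{c·m^v}⟩_m, so the remainders can be read back from it, and the map
-- is a bijection on partitions of n carrying the fibres of one monomial map onto those of the other.

module Submission where

open import Defs
open import Data.Bool using (true; false; if_then_else_)
open import Data.Fin using (Fin; toℕ) renaming (zero to fzero; suc to fsuc)
open import Data.Fin.Properties using (toℕ<n)
open import Data.Nat using (ℕ; zero; suc; _+_; _*_; _∸_; _≤_; _<_; z≤n; s≤s; NonZero; >-nonZero)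
open import Data.Nat.DivMod
open import Data.Nat.Divisibility using (_∣_; _∣?_; divides; 1∣_; n∣m*n; ∣m+n∣m⇒∣n; ∣⇒≤)
open import Data.Nat.Induction using (<-rec)
open import Data.Nat.Properties
open import Algebra.Properties.CommutativeSemigroup +-commutativeSemigroup
  using () renaming (interchange to +-interchange)
open import Data.Product using (Σ; ∃₂; _×_; _,_; proj₁; proj₂; map₂; uncurry)
open import Data.Product.Function.Dependent.Propositional using (Σ-↔)
open import Data.Sum using (inj₁; inj₂)
open import Data.Vec using (Vec; []; _∷_; sum; tabulate; lookup)
open import Data.Vec.Properties using (tabulate-cong; tabulate∘lookup)
open import Function using (_∘_)
open import Function.Bundles using (_↔_; mk↔ₛ′; Inverse)
open import Function.Properties.Inverse using (↔-refl; ↔-sym)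
open import Relation.Binary.PropositionalEquality
open import Relation.Nullary using (¬_; yes; no; does; contradiction)
open import Relation.Nullary.Decidable using (dec-true; dec-false)

sumTo : ℕ → (ℕ → ℕ) → ℕ
sumTo zero    f = 0
sumTo (suc N) f = sumTo N f + f (suc N)

sumTo-cong : ∀ N {f g : ℕ → ℕ} → (∀ x → 1 ≤ x → x ≤ N → f x ≡ g x) → sumTo N f ≡ sumTo N g
sumTo-cong zero    f≗g = refl
sumTo-cong (suc N) f≗g =
  cong₂ _+_ (sumTo-cong N (λ x 1≤x x≤N → f≗g x 1≤x (m≤n⇒m≤1+n x≤N))) (f≗g (suc N) (s≤s z≤n) ≤-refl)

sumTo-zero : ∀ N {f : ℕ → ℕ} → (∀ x → 1 ≤ x → x ≤ N → f x ≡ 0) → sumTo N f ≡ 0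
sumTo-zero zero    f≗0 = refl
sumTo-zero (suc N) f≗0 =
  cong₂ _+_ (sumTo-zero N (λ x 1≤x x≤N → f≗0 x 1≤x (m≤n⇒m≤1+n x≤N))) (f≗0 (suc N) (s≤s z≤n) ≤-refl)

sumTo-last : ∀ N (f : ℕ → ℕ) → (∀ x → 1 ≤ x → x < N → f x ≡ 0) → 1 ≤ N → sumTo N f ≡ f N
sumTo-last (suc N) f f≗0 _ = cong (_+ f (suc N)) (sumTo-zero N (λ x 1≤x x≤N → f≗0 x 1≤x (s≤s x≤N)))

sumTo-+ : ∀ N (f g : ℕ → ℕ) → sumTo N (λ x → f x + g x) ≡ sumTo N f + sumTo N g
sumTo-+ zero    f g = refl
sumTo-+ (suc N) f g =
  trans (cong (_+ (f (suc N) + g (suc N))) (sumTo-+ N f g)) (+-interchange (sumTo N f) (sumTo N g) (f (suc N)) (g (suc N)))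

sumTo-suc : ∀ N (f : ℕ → ℕ) → sumTo (suc N) f ≡ f 1 + sumTo N (f ∘ suc)
sumTo-suc zero    f = +-comm 0 (f 1)
sumTo-suc (suc N) f = trans (cong (_+ f (2 + N)) (sumTo-suc N f)) (+-assoc (f 1) _ _)

sumTo-split : ∀ a b (f : ℕ → ℕ) → sumTo (a + b) f ≡ sumTo a f + sumTo b (λ i → f (a + i))
sumTo-split a zero    f = trans (cong (λ k → sumTo k f) (+-identityʳ a)) (sym (+-identityʳ _))
sumTo-split a (suc b) f = begin
  sumTo (a + suc b) f                          ≡⟨ cong (λ k → sumTo k f) (+-suc a b) ⟩
  sumTo (a + b) f + f (suc (a + b))            ≡⟨ cong (_+ f (suc (a + b))) (sumTo-split a b f) ⟩
  sumTo a f + sumTo b g + f (suc (a + b))      ≡⟨ +-assoc (sumTo a f) (sumTo b g) _ ⟩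
  sumTo a f + (sumTo b g + f (suc (a + b)))    ≡⟨ cong (λ k → sumTo a f + (sumTo b g + f k)) (+-suc a b) ⟨
  sumTo a f + sumTo (suc b) g                  ∎
  where
  open ≡-Reasoning
  g : ℕ → ℕ
  g i = f (a + i)

sumTo-vanishing : ∀ {N M} (f : ℕ → ℕ) → N ≤ M → (∀ x → N < x → f x ≡ 0) → sumTo M f ≡ sumTo N f
sumTo-vanishing {N} {M} f N≤M f-vanishes = begin
  sumTo M f                                      ≡⟨ cong (λ k → sumTo k f) (sym (m+[n∸m]≡n N≤M)) ⟩
  sumTo (N + (M ∸ N)) f                          ≡⟨ sumTo-split N (M ∸ N) f ⟩
  sumTo N f + sumTo (M ∸ N) (λ i → f (N + i))    ≡⟨ cong (sumTo N f +_) (sumTo-zero (M ∸ N) tail≡0) ⟩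
  sumTo N f + 0                                  ≡⟨ +-identityʳ _ ⟩
  sumTo N f                                      ∎
  where
  open ≡-Reasoning
  tail≡0 : ∀ i → 1 ≤ i → i ≤ M ∸ N → f (N + i) ≡ 0
  tail≡0 i 1≤i _ = f-vanishes (N + i) (m<m+n N 1≤i)

term≤sumTo : ∀ N (f : ℕ → ℕ) {x} → 1 ≤ x → x ≤ N → f x ≤ sumTo N f
term≤sumTo zero    f () z≤n
term≤sumTo (suc N) f {x} 1≤x x≤1+N with m≤n⇒m<n∨m≡n x≤1+N
... | inj₁ (s≤s x≤N) = ≤-trans (term≤sumTo N f 1≤x x≤N) (m≤m+n _ _)
... | inj₂ refl      = m≤n+m _ _

sum-tabulate : ∀ n (f : ℕ → ℕ) → sum (tabulate {n = n} (λ i → f (suc (toℕ i)))) ≡ sumTo n f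
sum-tabulate zero    f = refl
sum-tabulate (suc n) f = trans (cong (f 1 +_) (sum-tabulate n (f ∘ suc))) (sym (sumTo-suc n f))

-- A multiplicity function T : ℕ → ℕ stands for the partition with T i parts equal to i.
Supported : ℕ → (ℕ → ℕ) → Set
Supported n T = T 0 ≡ 0 × (∀ x → n < x → T x ≡ 0)

weightFn : ℕ → (ℕ → ℕ) → ℕ
weightFn n T = sumTo n (λ j → j * T j)

toVec : ∀ n → (ℕ → ℕ) → Vec ℕ n
toVec n T = tabulate (λ i → T (suc (toℕ i)))

at-toVec : ∀ n (T : ℕ → ℕ) {j} → j < n → at (toVec n T) j ≡ T (suc j)
at-toVec (suc n) T {zero}  _         = refl
at-toVec (suc n) T {suc j} (s≤s j<n) = at-toVec n (T ∘ suc) j<n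

at-beyond : ∀ {n} (t : Vec ℕ n) {j} → n ≤ j → at t j ≡ 0
at-beyond []      _         = refl
at-beyond (_ ∷ t) (s≤s n≤j) = at-beyond t n≤j

lookup≡at : ∀ {n} (t : Vec ℕ n) (i : Fin n) → lookup t i ≡ at t (toℕ i)
lookup≡at (_ ∷ t) fzero    = refl
lookup≡at (_ ∷ t) (fsuc i) = lookup≡at t i

mult-supported : ∀ {n} (t : Vec ℕ n) → Supported n (mult t)
mult-supported t = refl , λ { (suc x) (s≤s n≤x) → at-beyond t n≤x }

toVec-mult : ∀ {n} (t : Vec ℕ n) → toVec n (mult t) ≡ t
toVec-mult t = trans (tabulate-cong (λ i → sym (lookup≡at t i))) (tabulate∘lookup t)

toVec-cong : ∀ n {T T' : ℕ → ℕ} → (∀ x → 1 ≤ x → x ≤ n → T x ≡ T' x) → toVec n T ≡ toVec n T'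
toVec-cong n T≗T' = tabulate-cong (λ i → T≗T' (suc (toℕ i)) (s≤s z≤n) (toℕ<n i))

mult-toVec : ∀ n {T : ℕ → ℕ} → Supported n T → ∀ x → mult (toVec n T) x ≡ T x
mult-toVec n (T0≡0 , _)         zero    = sym T0≡0
mult-toVec n {T} (_ , T-beyond) (suc x) with x <? n
... | yes x<n = at-toVec n T x<n
... | no  x≮n = trans (at-beyond (toVec n T) (≮⇒≥ x≮n)) (sym (T-beyond (suc x) (s≤s (≮⇒≥ x≮n))))

weightFn-cong : ∀ n {T T' : ℕ → ℕ} → (∀ x → 1 ≤ x → x ≤ n → T x ≡ T' x) → weightFn n T ≡ weightFn n T'
weightFn-cong n T≗T' = sumTo-cong n (λ j 1≤j j≤n → cong (j *_) (T≗T' j 1≤j j≤n))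

weight≡weightFn : ∀ {n} (t : Vec ℕ n) → weight t ≡ weightFn n (mult t)
weight≡weightFn {n} t =
  trans (cong sum (tabulate-cong (λ i → cong (suc (toℕ i) *_) (lookup≡at t i)))) (sum-tabulate n (λ j → j * mult t j))

weight-toVec : ∀ n {T : ℕ → ℕ} → Supported n T → weight (toVec n T) ≡ weightFn n T
weight-toVec n {T} T-supp = trans (weight≡weightFn (toVec n T)) (weightFn-cong n (λ x _ _ → mult-toVec n T-supp x))

part-bound : ∀ {n} (t : Vec ℕ n) → weight t ≡ n → ∀ x → x * mult t x ≤ n
part-bound t weight≡n zero = z≤n
part-bound {n} t weight≡n (suc x) with suc x ≤? n
... | yes 1+x≤n = ≤-trans (term≤sumTo n (λ j → j * mult t j) (s≤s z≤n) 1+x≤n)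
                          (≤-reflexive (trans (sym (weight≡weightFn t)) weight≡n))
... | no  1+x≰n = ≤-trans (≤-reflexive (trans (cong (suc x *_) mult≡0) (*-zeroʳ (suc x)))) z≤n
  where
  mult≡0 : mult t (suc x) ≡ 0
  mult≡0 = proj₂ (mult-supported t) (suc x) (≰⇒> 1+x≰n)

Partition-≡ : ∀ {n} {p q : Partition n} → proj₁ p ≡ proj₁ q → p ≡ q
Partition-≡ {p = t , _} refl = cong (t ,_) (≡-irrelevant _ _)

fibres-↔ : {A B C : Set} (f : A → C) (g : B → C) (φ : B ↔ A) →
           (∀ b → f (Inverse.to φ b) ≡ g b) → ∀ c → Σ A (λ a → f a ≡ c) ↔ Σ B (λ b → g b ≡ c)
fibres-↔ f g φ f∘φ≗g c =
  ↔-sym (Σ-↔ φ (λ {b} → subst (λ z → (g b ≡ c) ↔ (z ≡ c)) (sym (f∘φ≗g b)) ↔-refl))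

module Multiples (m : ℕ) where

  onMultiples : ℕ → ℕ → ℕ
  onMultiples x y = if does (m ∣? x) then y else 0

  offMultiples : ℕ → ℕ → ℕ
  offMultiples x y = if does (m ∣? x) then 0 else y

  onMultiples-∣ : ∀ {x} y → m ∣ x → onMultiples x y ≡ y
  onMultiples-∣ {x} y m∣x rewrite dec-true (m ∣? x) m∣x = refl

  onMultiples-∤ : ∀ {x} y → ¬ m ∣ x → onMultiples x y ≡ 0
  onMultiples-∤ {x} y m∤x rewrite dec-false (m ∣? x) m∤x = refl

  offMultiples-∣ : ∀ {x} y → m ∣ x → offMultiples x y ≡ 0
  offMultiples-∣ {x} y m∣x rewrite dec-true (m ∣? x) m∣x = refl

  onMultiples-zero : ∀ x → onMultiples x 0 ≡ 0
  onMultiples-zero x with does (m ∣? x)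
  ... | true  = refl
  ... | false = refl

  on+offMultiples : ∀ x y → onMultiples x y + offMultiples x y ≡ y
  on+offMultiples x y with does (m ∣? x)
  ... | true  = +-identityʳ y
  ... | false = refl

monoL₁≡monoR₁ : ∀ {n} (p : Partition n) → monoL 1 p ≡ monoR 1 p
monoL₁≡monoR₁ {n} (t , _) = cong₂ _,_ α₁≡α'₁ γ₁≡γ'₁
  where
  open Multiples 1

  α₁≡α'₁ : α 1 t ≡ α' 1 t
  α₁≡α'₁ = tabulate-cong (λ i → trans (cong (mult t) (*-identityʳ _)) (sym (n/1≡n _)))

  γ₁≡γ'₁ : γ 1 t ≡ γ' 1 t
  γ₁≡γ'₁ = begin
    γ 1 t                               ≡⟨ sum-tabulate n (λ j → offMultiples j (j * mult t j)) ⟩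
    sumTo n (λ j → offMultiples j (j * mult t j)) ≡⟨ sumTo-zero n (λ j _ _ → offMultiples-∣ _ (1∣ j)) ⟩
    0                                   ≡⟨ sumTo-zero n (λ j _ _ → trans (cong (j *_) (n%1≡0 (mult t j))) (*-zeroʳ j)) ⟨
    sumTo n (λ j → j * (mult t j % 1))  ≡⟨ sym (sum-tabulate n (λ j → j * (mult t j % 1))) ⟩
    γ' 1 t                              ∎
    where open ≡-Reasoning

module Glaisher (m : ℕ) .{{_ : NonZero m}} (1<m : 1 < m) where
  open Multiples m

  0%m≡0 : 0 % m ≡ 0
  0%m≡0 = m<n⇒m%n≡m (<-trans (s≤s z≤n) 1<m)

  [r+d*m]/m≡d : ∀ {r} d → r < m → (r + d * m) / m ≡ d
  [r+d*m]/m≡d {r} d r<m = trans (+-distrib-/-∣ʳ r (n∣m*n d)) (cong₂ _+_ (m<n⇒m/n≡0 r<m) (m*n/n≡m d m))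

  [r+d*m]%m≡r : ∀ {r} d → r < m → (r + d * m) % m ≡ r
  [r+d*m]%m≡r {r} d r<m = trans ([m+kn]%n≡m%n r d m) (m<n⇒m%n≡m r<m)

  few-large-parts : ∀ {n} {T : ℕ → ℕ} → (∀ x → x * T x ≤ n) → ∀ x → n < x * m → T x < m
  few-large-parts bound x n<x*m = ≰⇒> (λ m≤Tx → <⇒≱ n<x*m (≤-trans (*-monoʳ-≤ x m≤Tx) (bound x)))

  infixl 7 _·m^_ _/m^_ _%m^_

  _·m^_ : ℕ → ℕ → ℕ
  c ·m^ zero  = c
  c ·m^ suc a = c ·m^ a * m

  _/m^_ : ℕ → ℕ → ℕ
  y /m^ zero  = y
  y /m^ suc a = y /m^ a / m

  _%m^_ : ℕ → ℕ → ℕ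
  y %m^ zero  = 0
  y %m^ suc f = y % m + y / m %m^ f * m

  ·m^-suc : ∀ c a → c ·m^ suc a ≡ c * m ·m^ a
  ·m^-suc c zero    = refl
  ·m^-suc c (suc a) = cong (_* m) (·m^-suc c a)

  /m^-suc : ∀ y a → y /m^ suc a ≡ y / m /m^ a
  /m^-suc y zero    = refl
  /m^-suc y (suc a) = cong (_/ m) (/m^-suc y a)

  +≤·m^ : ∀ a {c} → 1 ≤ c → c + a ≤ c ·m^ a
  +≤·m^ zero    {c} _   = ≤-reflexive (+-identityʳ c)
  +≤·m^ (suc a) {c} 1≤c = begin
    c + suc a       ≡⟨ +-suc c a ⟩
    suc (c + a)     ≤⟨ s≤s (+≤·m^ a 1≤c) ⟩
    suc (c ·m^ a)   ≤⟨ m<m*n (c ·m^ a) m 1<m ⟩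
    c ·m^ a * m     ∎
    where
    open ≤-Reasoning
    instance
      c·m^a≢0 : NonZero (c ·m^ a)
      c·m^a≢0 = >-nonZero (≤-trans 1≤c (≤-trans (m≤m+n c a) (+≤·m^ a 1≤c)))

  <·m^ : ∀ a {c} → 1 ≤ c → a < c ·m^ a
  <·m^ a 1≤c = ≤-trans (+-monoˡ-≤ a 1≤c) (+≤·m^ a 1≤c)

  /m^-small : ∀ a {y c} → y * c < c ·m^ a → y /m^ a ≡ 0
  /m^-small zero    {zero}      _      = refl
  /m^-small zero    {suc y} {c} y*c<c  = contradiction (m≤m+n c (y * c)) (<⇒≱ y*c<c)
  /m^-small (suc a) {y}     {c} y*c<·m^ = trans (/m^-suc y a) (/m^-small a (begin-strict
    y / m * (c * m)  ≡⟨ cong (y / m *_) (*-comm c m) ⟩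
    y / m * (m * c)  ≡⟨ *-assoc (y / m) m c ⟨
    y / m * m * c    ≤⟨ *-monoˡ-≤ c (m/n*n≤m y m) ⟩
    y * c            <⟨ y*c<·m^ ⟩
    c ·m^ suc a      ≡⟨ ·m^-suc c a ⟩
    c * m ·m^ a      ∎))
    where open ≤-Reasoning

  /m^-≤ : ∀ a {y} → y ≤ a → y /m^ a ≡ 0
  /m^-≤ a {y} y≤a = /m^-small a (begin-strict
    y * 1    ≡⟨ *-identityʳ y ⟩
    y        <⟨ s≤s y≤a ⟩
    1 + a    ≤⟨ +≤·m^ a ≤-refl ⟩
    1 ·m^ a  ∎)
    where open ≤-Reasoning

  %m^-id : ∀ f y → y /m^ f ≡ 0 → y %m^ f ≡ y
  %m^-id zero    y y≡0 = sym y≡0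
  %m^-id (suc f) y y/m^f≡0 = begin
    y % m + y / m %m^ f * m  ≡⟨ cong (λ z → y % m + z * m) (%m^-id f (y / m) (trans (sym (/m^-suc y f)) y/m^f≡0)) ⟩
    y % m + y / m * m        ≡⟨ m≡m%n+[m/n]*n y m ⟨
    y                        ∎
    where open ≡-Reasoning

  undigits : ℕ → (ℕ → ℕ) → ℕ → ℕ
  undigits zero    T x = 0
  undigits (suc f) T x = T x % m + undigits f T (x * m) * m

  undigits-cong : ∀ f {T T' : ℕ → ℕ} → (∀ z → T z ≡ T' z) → ∀ x → undigits f T x ≡ undigits f T' x
  undigits-cong zero    T≗T' x = refl
  undigits-cong (suc f) T≗T' x = cong₂ (λ a b → a % m + b * m) (T≗T' x) (undigits-cong f T≗T' (x * m))

  undigits-stable : ∀ f T x → T (x ·m^ f) ≡ 0 → undigits (suc f) T x ≡ undigits f T x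
  undigits-stable zero    T x Tx≡0 = trans (+-identityʳ _) (trans (cong (_% m) Tx≡0) 0%m≡0)
  undigits-stable (suc f) T x T≡0 =
    cong (λ z → T x % m + z * m) (undigits-stable f T (x * m) (trans (cong T (sym (·m^-suc x f))) T≡0))

  undigits-beyond : ∀ f {n T x} → (∀ z → n < z → T z ≡ 0) → n < x → undigits f T x ≡ 0
  undigits-beyond zero    _          _   = refl
  undigits-beyond (suc f) {T = T} {x} T-beyond n<x = begin
    T x % m + undigits f T (x * m) * m  ≡⟨ cong₂ (λ a b → a % m + b * m) (T-beyond x n<x) (undigits-beyond f T-beyond n<x*m) ⟩
    0 % m + 0                           ≡⟨ +-identityʳ (0 % m) ⟩
    0 % m                               ≡⟨ 0%m≡0 ⟩
    0                                   ∎
    where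
    open ≡-Reasoning
    n<x*m : _ < x * m
    n<x*m = <-≤-trans n<x (m≤m*n x m)

  undigits-digit : ∀ f T y {a} → a < f → undigits f T y /m^ a % m ≡ T (y ·m^ a) % m
  undigits-digit (suc f) T y {zero}  _         = [r+d*m]%m≡r (undigits f T (y * m)) (m%n<n (T y) m)
  undigits-digit (suc f) T y {suc a} (s≤s a<f) = begin
    undigits (suc f) T y /m^ suc a % m  ≡⟨ cong (_% m) (/m^-suc _ a) ⟩
    undigits (suc f) T y / m /m^ a % m  ≡⟨ cong (λ z → z /m^ a % m) ([r+d*m]/m≡d (undigits f T (y * m)) (m%n<n (T y) m)) ⟩
    undigits f T (y * m) /m^ a % m      ≡⟨ undigits-digit f T (y * m) a<f ⟩
    T (y * m ·m^ a) % m                 ≡⟨ cong (λ z → T z % m) (·m^-suc y a) ⟨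
    T (y ·m^ suc a) % m                 ∎
    where open ≡-Reasoning

  Decomposition : ℕ → Set
  Decomposition x = ∃₂ λ c v → ¬ m ∣ c × 1 ≤ c × c ·m^ v ≡ x

  ·m^-decomposition : ∀ x → 1 ≤ x → Decomposition x
  ·m^-decomposition = <-rec _ decompose
    where
    decompose : ∀ x → (∀ {y} → y < x → 1 ≤ y → Decomposition y) → 1 ≤ x → Decomposition x
    decompose x rec 1≤x with m ∣? x
    ... | no  m∤x = x , 0 , m∤x , 1≤x , refl
    ... | yes m∣x with rec (m/n<m x m 1<m) (m≥n⇒m/n>0 (∣⇒≤ m∣x))
      where
      instance
        x≢0 : NonZero x
        x≢0 = >-nonZero 1≤x
    ...   | c , v , m∤c , 1≤c , c·m^v≡x/m = c , suc v , m∤c , 1≤c , trans (cong (_* m) c·m^v≡x/m) (m/n*n≡m m∣x)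

  -- stripZeros f x = (c , v) with x = c·m^v and m ∤ c, as long as x ≠ 0 and the fuel f is at least v
  stripZeros : ℕ → ℕ → ℕ × ℕ
  stripZeros zero    x = x , 0
  stripZeros (suc f) x with m ∣? x
  ... | yes _ = map₂ suc (stripZeros f (x / m))
  ... | no  _ = x , 0

  stripZeros-·m^ : ∀ {c} → ¬ m ∣ c → ∀ {a f} → a ≤ f → stripZeros f (c ·m^ a) ≡ (c , a)
  stripZeros-·m^ {c} m∤c {zero}  {zero}  _ = refl
  stripZeros-·m^ {c} m∤c {zero}  {suc f} _ with m ∣? c
  ... | yes m∣c = contradiction m∣c m∤c
  ... | no  _   = refl
  stripZeros-·m^ {c} m∤c {suc a} {suc f} (s≤s a≤f) with m ∣? c ·m^ a * m
  ... | yes _     = cong (map₂ suc) (trans (cong (stripZeros f) (m*n/n≡m (c ·m^ a) m)) (stripZeros-·m^ m∤c a≤f))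
  ... | no  m∤c·m = contradiction (n∣m*n (c ·m^ a)) m∤c·m

  digitAt : (ℕ → ℕ) → ℕ → ℕ
  digitAt s x = uncurry (λ c v → s c /m^ v % m) (stripZeros x x)

  digitAt-·m^ : ∀ s {c} a → ¬ m ∣ c → 1 ≤ c → digitAt s (c ·m^ a) ≡ s c /m^ a % m
  digitAt-·m^ s a m∤c 1≤c =
    cong (uncurry (λ c v → s c /m^ v % m)) (stripZeros-·m^ m∤c (<⇒≤ (<·m^ a 1≤c)))

  digitAt<m : ∀ s x → digitAt s x < m
  digitAt<m s x with stripZeros x x
  ... | c , v = m%n<n (s c /m^ v) m

  digitAt-cong : ∀ {s s' : ℕ → ℕ} → (∀ z → s z ≡ s' z) → ∀ x → digitAt s x ≡ digitAt s' x
  digitAt-cong s≗s' x with stripZeros x x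
  ... | c , v = cong (λ z → z /m^ v % m) (s≗s' c)

  sumTo-onMultiples : ∀ N (g : ℕ → ℕ) → sumTo (N * m) (λ x → onMultiples x (g x)) ≡ sumTo N (λ i → g (i * m))
  sumTo-onMultiples zero    g = refl
  sumTo-onMultiples (suc N) g = begin
    sumTo (m + N * m) h                              ≡⟨ cong (λ k → sumTo k h) (+-comm m (N * m)) ⟩
    sumTo (N * m + m) h                              ≡⟨ sumTo-split (N * m) m h ⟩
    sumTo (N * m) h + sumTo m (λ i → h (N * m + i))  ≡⟨ cong₂ _+_ (sumTo-onMultiples N g) block ⟩
    sumTo N (λ i → g (i * m)) + g (suc N * m)        ∎
    where
    open ≡-Reasoning
    h : ℕ → ℕ
    h x = onMultiples x (g x)

    m∤N*m+i : ∀ i → 1 ≤ i → i < m → ¬ m ∣ N * m + i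
    m∤N*m+i i 1≤i i<m m∣ = <⇒≱ i<m (∣⇒≤ {{>-nonZero 1≤i}} (∣m+n∣m⇒∣n m∣ (n∣m*n N)))

    block : sumTo m (λ i → h (N * m + i)) ≡ g (suc N * m)
    block = begin
      sumTo m (λ i → h (N * m + i))  ≡⟨ sumTo-last m _ (λ i 1≤i i<m → onMultiples-∤ _ (m∤N*m+i i 1≤i i<m)) (<⇒≤ 1<m) ⟩
      h (N * m + m)                  ≡⟨ onMultiples-∣ _ (subst (m ∣_) (+-comm m (N * m)) (n∣m*n (suc N))) ⟩
      g (N * m + m)                  ≡⟨ cong g (+-comm (N * m) m) ⟩
      g (suc N * m)                  ∎

  sumTo-multiples : ∀ n (g : ℕ → ℕ) → (∀ x → n < x → onMultiples x (g x) ≡ 0) →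
                    sumTo n (λ x → onMultiples x (g x)) ≡ sumTo n (λ i → g (i * m))
  sumTo-multiples n g vanishes = trans (sym (sumTo-vanishing _ (m≤m*n n m) vanishes)) (sumTo-onMultiples n g)

  glaisher : ℕ → (ℕ → ℕ) → ℕ → ℕ
  glaisher n T x = if does (m ∣? x) then T (x / m) / m else undigits n T x

  glaisher⁻¹ : (ℕ → ℕ) → ℕ → ℕ
  glaisher⁻¹ s x = digitAt s x + s (x * m) * m

  glaisher⁻¹-cong : ∀ {s s' : ℕ → ℕ} → (∀ z → s z ≡ s' z) → ∀ x → glaisher⁻¹ s x ≡ glaisher⁻¹ s' x
  glaisher⁻¹-cong s≗s' x = cong₂ (λ a b → a + b * m) (digitAt-cong s≗s' x) (s≗s' (x * m))

  glaisher⁻¹-< : ∀ {n s} → Supported n s → ∀ x → n < x * m → glaisher⁻¹ s x < m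
  glaisher⁻¹-< {s = s} (_ , s-beyond) x n<x*m =
    subst (_< m) (sym (trans (cong (λ z → digitAt s x + z * m) (s-beyond (x * m) n<x*m)) (+-identityʳ _))) (digitAt<m s x)

  undigits-glaisher⁻¹ : ∀ s f a {c} → ¬ m ∣ c → 1 ≤ c → undigits f (glaisher⁻¹ s) (c ·m^ a) ≡ s c /m^ a %m^ f
  undigits-glaisher⁻¹ s zero    a         _   _   = refl
  undigits-glaisher⁻¹ s (suc f) a {c} m∤c 1≤c =
    cong₂ (λ u w → u + w * m) digit (undigits-glaisher⁻¹ s f (suc a) m∤c 1≤c)
    where
    digit : glaisher⁻¹ s (c ·m^ a) % m ≡ s c /m^ a % m
    digit = trans ([r+d*m]%m≡r (s (c ·m^ a * m)) (digitAt<m s (c ·m^ a))) (digitAt-·m^ s a m∤c 1≤c)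

  module _ (n : ℕ) where

    glaisher-∣ : ∀ T {x} → m ∣ x → glaisher n T x ≡ T (x / m) / m
    glaisher-∣ T {x} m∣x rewrite dec-true (m ∣? x) m∣x = refl

    glaisher-∤ : ∀ T {x} → ¬ m ∣ x → glaisher n T x ≡ undigits n T x
    glaisher-∤ T {x} m∤x rewrite dec-false (m ∣? x) m∤x = refl

    glaisher-cong : ∀ {T T' : ℕ → ℕ} → (∀ z → T z ≡ T' z) → ∀ x → glaisher n T x ≡ glaisher n T' x
    glaisher-cong T≗T' x with m ∣? x
    ... | yes _ = cong (_/ m) (T≗T' (x / m))
    ... | no  _ = undigits-cong n T≗T' x

    merged-beyond : ∀ {T : ℕ → ℕ} → (∀ x → n < x * m → T x < m) → ∀ {x} → m ∣ x → n < x → T (x / m) / m ≡ 0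
    merged-beyond T-small {x} m∣x n<x = m<n⇒m/n≡0 (T-small (x / m) (subst (n <_) (sym (m/n*n≡m m∣x)) n<x))

    glaisher-supported : ∀ {T} → Supported n T → (∀ x → n < x * m → T x < m) → Supported n (glaisher n T)
    glaisher-supported {T} (T0≡0 , T-beyond) T-small = G0≡0 , G-beyond
      where
      G0≡0 : glaisher n T 0 ≡ 0
      G0≡0 = begin
        glaisher n T 0  ≡⟨ glaisher-∣ T (divides 0 refl) ⟩
        T (0 / m) / m   ≡⟨ cong (λ z → T z / m) (0/n≡0 m) ⟩
        T 0 / m         ≡⟨ cong (_/ m) T0≡0 ⟩
        0 / m           ≡⟨ 0/n≡0 m ⟩
        0               ∎
        where open ≡-Reasoning

      G-beyond : ∀ x → n < x → glaisher n T x ≡ 0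
      G-beyond x n<x with m ∣? x
      ... | yes m∣x = merged-beyond T-small m∣x n<x
      ... | no  _   = undigits-beyond n T-beyond n<x

    glaisher⁻¹-supported : ∀ {s} → Supported n s → (∀ x → x * s x ≤ n) → Supported n (glaisher⁻¹ s)
    glaisher⁻¹-supported {s} (s0≡0 , s-beyond) s-bound = H0≡0 , H-beyond
      where
      H0≡0 : glaisher⁻¹ s 0 ≡ 0
      H0≡0 = trans (cong (λ z → z % m + z * m) s0≡0) (trans (+-identityʳ _) 0%m≡0)

      H-beyond : ∀ x → n < x → glaisher⁻¹ s x ≡ 0
      H-beyond x n<x with ·m^-decomposition x (≤-trans (s≤s z≤n) n<x)
      ... | c , v , m∤c , 1≤c , refl = begin
        digitAt s (c ·m^ v) + s (c ·m^ v * m) * m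
          ≡⟨ cong₂ (λ a b → a + b * m) (digitAt-·m^ s v m∤c 1≤c) (s-beyond _ (<-≤-trans n<x (m≤m*n _ m))) ⟩
        s c /m^ v % m + 0
          ≡⟨ cong (λ z → z % m + 0) (/m^-small v s[c]*c<c·m^v) ⟩
        0 % m + 0
          ≡⟨ trans (+-identityʳ _) 0%m≡0 ⟩
        0 ∎
        where
        open ≡-Reasoning
        s[c]*c<c·m^v : s c * c < c ·m^ v
        s[c]*c<c·m^v = ≤-<-trans (≤-reflexive (*-comm (s c) c)) (≤-<-trans (s-bound c) n<x)

    glaisher∘glaisher⁻¹ : ∀ {s} → (∀ x → x * s x ≤ n) → ∀ x → 1 ≤ x → glaisher n (glaisher⁻¹ s) x ≡ s x
    glaisher∘glaisher⁻¹ {s} s-bound x 1≤x with m ∣? x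
    ... | yes m∣x = begin
      (digitAt s (x / m) + s (x / m * m) * m) / m  ≡⟨ [r+d*m]/m≡d _ (digitAt<m s (x / m)) ⟩
      s (x / m * m)                                 ≡⟨ cong s (m/n*n≡m m∣x) ⟩
      s x                                           ∎
      where open ≡-Reasoning
    ... | no  m∤x = begin
      undigits n (glaisher⁻¹ s) x  ≡⟨ undigits-glaisher⁻¹ s n 0 m∤x 1≤x ⟩
      s x %m^ n                    ≡⟨ %m^-id n (s x) (/m^-≤ n s[x]≤n) ⟩
      s x                          ∎
      where
      open ≡-Reasoning
      s[x]≤n : s x ≤ n
      s[x]≤n = ≤-trans (m≤n*m (s x) x {{>-nonZero 1≤x}}) (s-bound x)

    glaisher⁻¹∘glaisher : ∀ T x → 1 ≤ x → x ≤ n → glaisher⁻¹ (glaisher n T) x ≡ T x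
    glaisher⁻¹∘glaisher T x 1≤x x≤n with ·m^-decomposition x 1≤x
    ... | c , v , m∤c , 1≤c , refl = begin
      digitAt (glaisher n T) y + glaisher n T (y * m) * m
        ≡⟨ cong₂ (λ a b → a + b * m) (digitAt-·m^ (glaisher n T) v m∤c 1≤c) (glaisher-∣ T (n∣m*n y)) ⟩
      glaisher n T c /m^ v % m + T (y * m / m) / m * m
        ≡⟨ cong₂ (λ a b → a /m^ v % m + T b / m * m) (glaisher-∤ T m∤c) (m*n/n≡m y m) ⟩
      undigits n T c /m^ v % m + T y / m * m
        ≡⟨ cong (_+ T y / m * m) (undigits-digit n T c (<-≤-trans (<·m^ v 1≤c) x≤n)) ⟩
      T y % m + T y / m * m
        ≡⟨ m≡m%n+[m/n]*n (T y) m ⟨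
      T y ∎
      where
      open ≡-Reasoning
      y : ℕ
      y = c ·m^ v

    -- The weight of undigits (f + 1) T is C plus the part of the weight of undigits f T carried by
    -- multiples of m; for f = n both weights are equal, which leaves C for the remaining part.
    remainder-weight : ∀ {T} → Supported n T →
      sumTo n (λ j → offMultiples j (j * undigits n T j)) ≡ sumTo n (λ j → j * (T j % m))
    remainder-weight {T} (_ , T-beyond) = +-cancelˡ-≡ (X n) (Y n) C (begin
      X n + Y n   ≡⟨ W-split n ⟨
      W n         ≡⟨ W-stable ⟨
      W (suc n)   ≡⟨ W-suc n ⟩
      C + X n     ≡⟨ +-comm C (X n) ⟩
      X n + C     ∎)
      where
      open ≡-Reasoning
      W X Y : ℕ → ℕ
      W f = weightFn n (undigits f T)
      X f = sumTo n (λ j → onMultiples j (j * undigits f T j))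
      Y f = sumTo n (λ j → offMultiples j (j * undigits f T j))
      C : ℕ
      C = sumTo n (λ j → j * (T j % m))

      W-split : ∀ f → W f ≡ X f + Y f
      W-split f = trans (sumTo-cong n (λ j _ _ → sym (on+offMultiples j _))) (sumTo-+ n _ _)

      W-stable : W (suc n) ≡ W n
      W-stable = weightFn-cong n (λ j 1≤j _ →
        undigits-stable n T j (T-beyond _ (<-≤-trans (m<n+m n 1≤j) (+≤·m^ n 1≤j))))

      W-suc : ∀ f → W (suc f) ≡ C + X f
      W-suc f = begin
        sumTo n (λ j → j * (T j % m + undigits f T (j * m) * m))   ≡⟨ sumTo-cong n (λ j _ _ → distrib j) ⟩
        sumTo n (λ j → j * (T j % m) + j * m * undigits f T (j * m)) ≡⟨ sumTo-+ n _ _ ⟩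
        C + sumTo n (λ j → j * m * undigits f T (j * m))             ≡⟨ cong (C +_) (sumTo-multiples n (λ y → y * undigits f T y) vanishes) ⟨
        C + X f                                                      ∎
        where
        distrib : ∀ j → j * (T j % m + undigits f T (j * m) * m) ≡ j * (T j % m) + j * m * undigits f T (j * m)
        distrib j = trans (*-distribˡ-+ j _ _)
          (cong (j * (T j % m) +_) (trans (cong (j *_) (*-comm _ m)) (sym (*-assoc j m _))))
        vanishes : ∀ x → n < x → onMultiples x (x * undigits f T x) ≡ 0
        vanishes x n<x = begin
          onMultiples x (x * undigits f T x)  ≡⟨ cong (λ z → onMultiples x (x * z)) (undigits-beyond f T-beyond n<x) ⟩
          onMultiples x (x * 0)               ≡⟨ cong (onMultiples x) (*-zeroʳ x) ⟩
          onMultiples x 0                     ≡⟨ onMultiples-zero x ⟩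
          0                                   ∎

    glaisher-weight : ∀ {T} → Supported n T → (∀ x → n < x * m → T x < m) → weightFn n (glaisher n T) ≡ weightFn n T
    glaisher-weight {T} T-supported T-small = begin
      sumTo n (λ j → j * glaisher n T j)
        ≡⟨ sumTo-cong n (λ j _ _ → split j) ⟩
      sumTo n (λ j → onMultiples j (g j) + offMultiples j (j * undigits n T j))
        ≡⟨ sumTo-+ n _ _ ⟩
      sumTo n (λ j → onMultiples j (g j)) + sumTo n (λ j → offMultiples j (j * undigits n T j))
        ≡⟨ cong₂ _+_ (sumTo-multiples n g g-vanishes) (remainder-weight T-supported) ⟩
      sumTo n (λ i → g (i * m)) + sumTo n (λ i → i * (T i % m))
        ≡⟨ sumTo-+ n _ _ ⟨
      sumTo n (λ i → g (i * m) + i * (T i % m))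
        ≡⟨ sumTo-cong n (λ i _ _ → recombine i) ⟩
      sumTo n (λ i → i * T i)
        ∎
      where
      open ≡-Reasoning
      g : ℕ → ℕ
      g j = j * (T (j / m) / m)

      split : ∀ j → j * glaisher n T j ≡ onMultiples j (g j) + offMultiples j (j * undigits n T j)
      split j with m ∣? j
      ... | yes _ = sym (+-identityʳ _)
      ... | no  _ = refl

      g-vanishes : ∀ x → n < x → onMultiples x (g x) ≡ 0
      g-vanishes x n<x with m ∣? x
      ... | yes m∣x = trans (cong (x *_) (merged-beyond T-small m∣x n<x)) (*-zeroʳ x)
      ... | no  _   = refl

      recombine : ∀ i → g (i * m) + i * (T i % m) ≡ i * T i
      recombine i = begin
        i * m * (T (i * m / m) / m) + i * (T i % m)  ≡⟨ cong (λ z → i * m * (T z / m) + i * (T i % m)) (m*n/n≡m i m) ⟩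
        i * m * (T i / m) + i * (T i % m)            ≡⟨ +-comm (i * m * (T i / m)) _ ⟩
        i * (T i % m) + i * m * (T i / m)            ≡⟨ cong (i * (T i % m) +_) (trans (*-assoc i m _) (cong (i *_) (*-comm m _))) ⟩
        i * (T i % m) + i * (T i / m * m)            ≡⟨ *-distribˡ-+ i _ _ ⟨
        i * (T i % m + T i / m * m)                  ≡⟨ cong (i *_) (m≡m%n+[m/n]*n (T i) m) ⟨
        i * T i                                      ∎

    module _ {t : Vec ℕ n} (weight≡n : weight t ≡ n) where

      mult-small : ∀ x → n < x * m → mult t x < m
      mult-small = few-large-parts (part-bound t weight≡n)

      glaisher-mult-supported : Supported n (glaisher n (mult t))
      glaisher-mult-supported = glaisher-supported (mult-supported t) mult-small

      glaisher⁻¹-mult-supported : Supported n (glaisher⁻¹ (mult t))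
      glaisher⁻¹-mult-supported = glaisher⁻¹-supported (mult-supported t) (part-bound t weight≡n)

      weight-glaisher : weight (toVec n (glaisher n (mult t))) ≡ n
      weight-glaisher = begin
        weight (toVec n (glaisher n (mult t)))  ≡⟨ weight-toVec n glaisher-mult-supported ⟩
        weightFn n (glaisher n (mult t))        ≡⟨ glaisher-weight (mult-supported t) mult-small ⟩
        weightFn n (mult t)                     ≡⟨ weight≡weightFn t ⟨
        weight t                                ≡⟨ weight≡n ⟩
        n                                       ∎
        where open ≡-Reasoning

      weight-glaisher⁻¹ : weight (toVec n (glaisher⁻¹ (mult t))) ≡ n
      weight-glaisher⁻¹ = begin
        weight (toVec n H)             ≡⟨ weight-toVec n glaisher⁻¹-mult-supported ⟩
        weightFn n H                   ≡⟨ glaisher-weight glaisher⁻¹-mult-supported (glaisher⁻¹-< (mult-supported t)) ⟨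
        weightFn n (glaisher n H)      ≡⟨ weightFn-cong n (λ x 1≤x _ → glaisher∘glaisher⁻¹ (part-bound t weight≡n) x 1≤x) ⟩
        weightFn n (mult t)            ≡⟨ weight≡weightFn t ⟨
        weight t                       ≡⟨ weight≡n ⟩
        n                              ∎
        where
        open ≡-Reasoning
        H : ℕ → ℕ
        H = glaisher⁻¹ (mult t)

    glaisherₚ : Partition n → Partition n
    glaisherₚ (t , weight≡n) = toVec n (glaisher n (mult t)) , weight-glaisher weight≡n

    glaisher⁻¹ₚ : Partition n → Partition n
    glaisher⁻¹ₚ (s , weight≡n) = toVec n (glaisher⁻¹ (mult s)) , weight-glaisher⁻¹ weight≡n

    glaisher-↔ : Partition n ↔ Partition n
    glaisher-↔ = mk↔ₛ′ glaisherₚ glaisher⁻¹ₚ glaisherₚ∘glaisher⁻¹ₚ glaisher⁻¹ₚ∘glaisherₚ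
      where
      glaisherₚ∘glaisher⁻¹ₚ : ∀ p → glaisherₚ (glaisher⁻¹ₚ p) ≡ p
      glaisherₚ∘glaisher⁻¹ₚ (s , weight≡n) = Partition-≡ (trans
        (toVec-cong n (λ x 1≤x _ → trans (glaisher-cong (mult-toVec n (glaisher⁻¹-mult-supported weight≡n)) x)
                                         (glaisher∘glaisher⁻¹ (part-bound s weight≡n) x 1≤x)))
        (toVec-mult s))

      glaisher⁻¹ₚ∘glaisherₚ : ∀ p → glaisher⁻¹ₚ (glaisherₚ p) ≡ p
      glaisher⁻¹ₚ∘glaisherₚ (t , weight≡n) = Partition-≡ (trans
        (toVec-cong n (λ x 1≤x x≤n → trans (glaisher⁻¹-cong (mult-toVec n (glaisher-mult-supported weight≡n)) x)
                                           (glaisher⁻¹∘glaisher (mult t) x 1≤x x≤n)))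
        (toVec-mult t))

    monoL-glaisherₚ : ∀ p → monoL m (glaisherₚ p) ≡ monoR m p
    monoL-glaisherₚ (t , weight≡n) = cong₂ _,_ α≡α' γ≡γ'
      where
      G : ℕ → ℕ
      G = glaisher n (mult t)

      mult-G : ∀ x → mult (toVec n G) x ≡ G x
      mult-G = mult-toVec n (glaisher-mult-supported weight≡n)

      α≡α' : α m (toVec n G) ≡ α' m t
      α≡α' = tabulate-cong (λ i → let k = suc (toℕ i) in
        trans (mult-G (k * m)) (trans (glaisher-∣ _ (n∣m*n k)) (cong (λ z → mult t z / m) (m*n/n≡m k m))))

      off : ∀ j → offMultiples j (j * mult (toVec n G) j) ≡ offMultiples j (j * undigits n (mult t) j)
      off j with m ∣? j
      ... | yes _   = refl
      ... | no  m∤j = cong (j *_) (trans (mult-G j) (glaisher-∤ _ m∤j))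

      γ≡γ' : γ m (toVec n G) ≡ γ' m t
      γ≡γ' = begin
        γ m (toVec n G)                                              ≡⟨ sum-tabulate n _ ⟩
        sumTo n (λ j → offMultiples j (j * mult (toVec n G) j))      ≡⟨ sumTo-cong n (λ j _ _ → off j) ⟩
        sumTo n (λ j → offMultiples j (j * undigits n (mult t) j))   ≡⟨ remainder-weight (mult-supported t) ⟩
        sumTo n (λ j → j * (mult t j % m))                           ≡⟨ sum-tabulate n _ ⟨
        γ' m t                                                       ∎
        where open ≡-Reasoning

theorem2p1 : (m n : ℕ) → .{{_ : NonZero m}} → .{{_ : NonZero n}} →
    (e : Monomial n) →
    Σ (Partition n) (λ p → monoL m p ≡ e) ↔ Σ (Partition n) (λ p → monoR m p ≡ e)
theorem2p1 zero              n {{()}}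
theorem2p1 1                 n e = fibres-↔ (monoL 1) (monoR 1) ↔-refl monoL₁≡monoR₁ e
theorem2p1 m@(suc (suc _))   n e =
  fibres-↔ (monoL m) (monoR m) (Glaisher.glaisher-↔ m 1<m n) (Glaisher.monoL-glaisherₚ m 1<m n) e
  where
  1<m : 1 < m
  1<m = s≤s (s≤s z≤n)
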